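{- Let $Q$ be a set of snapshots and $x: A\to B$ a refob with $Q\vdash\mathrm{Chain}(x)$. Then for any finalized subset $Q_f$ of $Q$ with $B\in\mathrm{dom}(Q_f)$, we have $Q_f\vdash\mathrm{Chain}(x)$.
   Context: A refob is a triple $(x,A,B)$ of a token $x$, owner actor $A$ and target actor $B$, written $x: A\to B$. A fact is one of $\mathrm{Created}(x)$, $\mathrm{Released}(x)$, $\mathrm{CreatedUsing}(x,y)$, $\mathrm{Activated}(x)$, $\mathrm{Unreleased}(x)$, $\mathrm{SentCount}(x,n)$, $\mathrm{RecvCount}(x,n)$ ($n\in\mathbb N$). A knowledge set $\Phi$ is a finite set of facts; $\Phi\vdash\varphi$ means $\varphi$ is derivable from $\Phi$ in first-order logic plus the rules: if no $\mathrm{SentCount}(x,n)\in\Phi$ then $\Phi\vdash\mathrm{SentCount}(x,0)$; if no $\mathrm{RecvCount}(x,n)\in\Phi$ then $\Phi\vdash\mathrm{RecvCount}(x,0)$; if $\Phi\vdash\mathrm{Created}(x)$ and $\Phi\not\vdash\mathrm{Released}(x)$ then $\Phi\vdash\mathrm{Unreleased}(x)$; if $\Phi\vdash\mathrm{CreatedUsing}(x,y)$ then $\Phi\vdash\mathrm{Created}(y)$. A set of snapshots $Q$ is a finite partial map from actors to knowledge sets; a subset of $Q$ is a restriction of $Q$ to a subset of $\mathrm{dom}(Q)$. For a refob $x:A\to B$: $Q\vdash\mathrm{Activated}(x)$, $Q\vdash\mathrm{SentCount}(x,n)$, $Q\vdash\mathrm{CreatedUsing}(x,y)$ mean $A\in\mathrm{dom}(Q)$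 and $Q(A)$ derives the fact; $Q\vdash\mathrm{Created}(x)$, $Q\vdash\mathrm{Released}(x)$, $Q\vdash\mathrm{RecvCount}(x,n)$ mean $B\in\mathrm{dom}(Q)$ and $Q(B)$ derives the fact. $Q\vdash\mathrm{Chain}(x:A\to B)$ iff there are refobs $x_1:A_1\to B,\dots,x_n:A_n\to B$ with $Q\vdash\mathrm{Created}(x_1)$, $Q\not\vdash\mathrm{Released}(x_1)$, for all $i<n$ $Q\vdash\mathrm{CreatedUsing}(x_i,x_{i+1})$ and $Q\not\vdash\mathrm{Released}(x_{i+1})$, and $A_n=A$, $x_n=x$. $Q\vdash\mathrm{Relevant}(x)$ iff for some $n$, $Q\vdash\mathrm{Activated}(x)$, $Q\vdash\mathrm{SentCount}(x,n)$ and $Q\vdash\mathrm{RecvCount}(x,n)$. $Q$ is finalized if for all $B\in\mathrm{dom}(Q)$ and all refobs $x:A\to B$, $Q\vdash\mathrm{Chain}(x)$ implies $A\in\mathrm{dom}(Q)$ and $Q\vdash\mathrm{Relevant}(x)$. -}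

module Defs where

open import Data.Nat using (ℕ; zero)
open import Data.List using (List)
open import Data.List.Membership.Propositional using (_∈_; _∉_)
open import Data.Maybe using (Maybe; just)
open import Data.Product using (Σ; ∃; _×_)
open import Relation.Binary.PropositionalEquality using (_≡_)
open import Relation.Nullary using (¬_)

-- A refob x : A → B : token, owner actor A, target actor B.
record Refob (Token Actor : Set) : Set where
  constructor refob
  field
    token  : Token
    owner  : Actor
    target : Actor
open Refob public

data Fact (Token Actor : Set) : Set where
  Created      : Refob Token Actor → Fact Token Actor
  Released     : Refob Token Actor → Fact Token Actor
  CreatedUsing : Refob Token Actor → Refob Token Actor → Fact Token Actor
  Activated    : Refob Token Actor → Fact Token Actor
  Unreleased   : Refob Token Actor → Fact Token Actor
  SentCount    : Refob Token Actor → ℕ → Fact Token Actor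
  RecvCount    : Refob Token Actor → ℕ → Fact Token Actor

-- A knowledge set is a finite set of facts (a list, read up to membership).
KnowledgeSet : Set → Set → Set
KnowledgeSet Token Actor = List (Fact Token Actor)

-- Since the Unreleased rule has a negative premise, the
-- closure is stratified: first ⊢₀ (everything except the Unreleased rule),
-- then ⊢ adds the Unreleased rule whose premises refer to ⊢₀ (no rule of
-- ⊢₀ has an Unreleased premise, so this is the intended closure).
data _⊢₀_ {Token Actor : Set} (Φ : KnowledgeSet Token Actor) : Fact Token Actor → Set where
  axiom    : ∀ {φ} → φ ∈ Φ → Φ ⊢₀ φ
  sent0    : ∀ {x} → (∀ n → SentCount x n ∉ Φ) → Φ ⊢₀ SentCount x zero
  recv0    : ∀ {x} → (∀ n → RecvCount x n ∉ Φ) → Φ ⊢₀ RecvCount x zero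
  createdU : ∀ {x y} → Φ ⊢₀ CreatedUsing x y → Φ ⊢₀ Created y

data _⊢_ {Token Actor : Set} (Φ : KnowledgeSet Token Actor) : Fact Token Actor → Set where
  base  : ∀ {φ} → Φ ⊢₀ φ → Φ ⊢ φ
  unrel : ∀ {x} → Φ ⊢₀ Created x → ¬ (Φ ⊢₀ Released x) → Φ ⊢ Unreleased x

-- A set of snapshots: a partial map from actors to knowledge sets
-- (finiteness of the domain is a separate predicate FiniteDom).
Snapshots : Set → Set → Set
Snapshots Token Actor = Actor → Maybe (KnowledgeSet Token Actor)

module _ {Token Actor : Set} where

  _∈dom_ : Actor → Snapshots Token Actor → Set
  a ∈dom Q = ∃ λ K → Q a ≡ just K

  FiniteDom : Snapshots Token Actor → Set
  FiniteDom Q = Σ (List Actor) λ L → ∀ a → a ∈dom Q → a ∈ L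

  _⊆Q_ : Snapshots Token Actor → Snapshots Token Actor → Set
  Q' ⊆Q Q = ∀ a K → Q' a ≡ just K → Q a ≡ just K

  _⊢_at_ : Snapshots Token Actor → Fact Token Actor → Actor → Set
  Q ⊢ φ at a = ∃ λ K → (Q a ≡ just K) × (K ⊢ φ)

  _⊢Activated_ : Snapshots Token Actor → Refob Token Actor → Set
  Q ⊢Activated x = Q ⊢ Activated x at owner x

  _⊢SentCount_,_ : Snapshots Token Actor → Refob Token Actor → ℕ → Set
  Q ⊢SentCount x , n = Q ⊢ SentCount x n at owner x

  _⊢CreatedUsing_,_ : Snapshots Token Actor → Refob Token Actor → Refob Token Actor → Set
  Q ⊢CreatedUsing x , y = Q ⊢ CreatedUsing x y at owner x

  _⊢Created_ : Snapshots Token Actor → Refob Token Actor → Set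
  Q ⊢Created x = Q ⊢ Created x at target x

  _⊢Released_ : Snapshots Token Actor → Refob Token Actor → Set
  Q ⊢Released x = Q ⊢ Released x at target x

  _⊢RecvCount_,_ : Snapshots Token Actor → Refob Token Actor → ℕ → Set
  Q ⊢RecvCount x , n = Q ⊢ RecvCount x n at target x

  -- Q ⊢ Chain(x): a sequence x₁,…,xₙ = x of refobs with common target,
  -- Created(x₁), ¬Released(x₁), CreatedUsing(xᵢ,xᵢ₊₁), ¬Released(xᵢ₊₁).
  -- Given inductively on the length of the sequence (last element indexed).
  data Chain (Q : Snapshots Token Actor) : Refob Token Actor → Set where
    start : ∀ {x} → Q ⊢Created x → ¬ (Q ⊢Released x) → Chain Q x
    next  : ∀ {y x} → Chain Q y → Q ⊢CreatedUsing y , x → target y ≡ target x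
          → ¬ (Q ⊢Released x) → Chain Q x

  Relevant : Snapshots Token Actor → Refob Token Actor → Set
  Relevant Q x = ∃ λ n → (Q ⊢Activated x) × (Q ⊢SentCount x , n) × (Q ⊢RecvCount x , n)

  Finalized : Snapshots Token Actor → Set
  Finalized Q = ∀ (x : Refob Token Actor) → target x ∈dom Q → Chain Q x
              → (owner x ∈dom Q) × Relevant Q x

-- A subset of Q agrees with Q wherever it is
-- defined, so facts at actors of dom(Qf) transfer from Q to Qf, and
-- non-releases transfer because every Qf-fact is a Q-fact. The one actor not
-- known to lie in dom(Qf) is the owner of the predecessor y of a
-- CreatedUsing step; but y has the same target, so Chain Qf y (by induction)
-- and finalization of Qf put that owner in dom(Qf).
module Submission where

open import Defs
open import Data.Product using (_,_; proj₁)
open import Data.Maybe.Properties using (just-injective)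
open import Relation.Binary.PropositionalEquality using (refl; trans; sym; subst)

module _ {Token Actor : Set} {Q Qf : Snapshots Token Actor} (Qf⊆Q : Qf ⊆Q Q) where

  ⊢at-extend : ∀ {φ a} → Qf ⊢ φ at a → Q ⊢ φ at a
  ⊢at-extend {a = a} (K , Qf[a]≡K , K⊢φ) = K , Qf⊆Q a K Qf[a]≡K , K⊢φ

  ⊢at-restrict : ∀ {φ a} → a ∈dom Qf → Q ⊢ φ at a → Qf ⊢ φ at a
  ⊢at-restrict {a = a} (K′ , Qf[a]≡K′) (K , Q[a]≡K , K⊢φ)
    with just-injective (trans (sym (Qf⊆Q a K′ Qf[a]≡K′)) Q[a]≡K)
  ... | refl = K′ , Qf[a]≡K′ , K⊢φ

  Chain-restrict : Finalized Qf → ∀ {x} → target x ∈dom Qf → Chain Q x → Chain Qf x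
  Chain-restrict fin tx∈Qf (start created unreleased) =
    start (⊢at-restrict tx∈Qf created) (λ released → unreleased (⊢at-extend released))
  Chain-restrict fin tx∈Qf (next {y} chain createdUsing y→x unreleased) =
    next chainᶠ
         (⊢at-restrict (proj₁ (fin y ty∈Qf chainᶠ)) createdUsing)
         y→x
         (λ released → unreleased (⊢at-extend released))
    where
    ty∈Qf : target y ∈dom Qf
    ty∈Qf = subst (_∈dom Qf) (sym y→x) tx∈Qf

    chainᶠ : Chain Qf y
    chainᶠ = Chain-restrict fin ty∈Qf chain

lemma7p3 : {Token Actor : Set} (Q : Snapshots Token Actor) → FiniteDom Q
         → (x : Refob Token Actor) → Chain Q x
         → (Qf : Snapshots Token Actor) → Qf ⊆Q Q → Finalized Qf
         → target x ∈dom Qf → Chain Qf x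
lemma7p3 Q _ x chain Qf Qf⊆Q fin tx∈Qf = Chain-restrict Qf⊆Q fin tx∈Qf chain
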